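{- Let $n\geq 2$ be an integer, let $H$ be any graph of order $r$, $2\leq r\leq n$, without isolated vertices, and let $G$ be a generalized corona of $H$ having exactly $n$ leaves. Then (i) $D_{r+n}^t(G)\cong Q_n$, and (ii) $D_{r+1}^t(G)\cong K_{1,n}$.
   Context: A generalized corona of a graph $H$ is a graph obtained by joining each vertex of $H$ to one or more new leaves (vertices of degree $1$). The hypercube $Q_n$ is the graph whose vertices are the $2^n$ subsets of an $n$-set, two being adjacent if and only if one is obtained from the other by deleting a single element. A total dominating set (TDS) of a graph without isolated vertices is a vertex set $S$ such that every vertex is adjacent to a vertex of $S$. For a positive integer $k$, $D_k^t(G)$ is the graph whose vertices are the TDSs of $G$ of cardinality at most $k$, two being adjacent if and only if one is obtained from the other by adding or deleting a single vertex. -}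

module Defs where

open import Data.Nat using (ℕ; zero; suc; _+_; _≤ᵇ_)
open import Data.Bool using (Bool; true; false; _∧_; T)
open import Data.Fin using (Fin; zero; splitAt)
open import Data.Fin.Properties using (_≟_)
open import Data.Fin.Subset using (Subset; ∣_∣)
open import Data.Vec using (lookup; _[_]≔_)
open import Data.List using (allFin)
open import Data.Bool.ListAction using (all; any)
open import Data.Sum using (_⊎_; inj₁; inj₂)
open import Data.Product using (Σ; ∃; _×_; _,_)
open import Relation.Nullary using (¬_)
open import Relation.Nullary.Decidable using (⌊_⌋)
open import Relation.Binary.PropositionalEquality using (_≡_)
open import Function.Bundles using (_↔_; _⇔_; Inverse)

record FinGraph (m : ℕ) : Set where
  field adj : Fin m → Fin m → Bool
open FinGraph public

IsSimple : {m : ℕ} → FinGraph m → Set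
IsSimple H = (∀ u v → adj H u v ≡ adj H v u) × (∀ v → adj H v v ≡ false)

NoIsolated : {m : ℕ} → FinGraph m → Set
NoIsolated H = ∀ v → ∃ λ u → T (adj H v u)

-- Generalized corona of H on r vertices with n new leaves:
-- vertices Fin (r + n); the first r are the vertices of H, the last n are
-- the leaves; leaf j is joined to vertex (att j) of H.  Each vertex of H
-- receiving one or more leaves is the hypothesis that att is surjective.
corona : {r n : ℕ} → FinGraph r → (Fin n → Fin r) → FinGraph (r + n)
adj (corona {r} H att) x y with splitAt r x | splitAt r y
... | inj₁ a | inj₁ b = adj H a b
... | inj₁ a | inj₂ j = ⌊ a ≟ att j ⌋
... | inj₂ j | inj₁ a = ⌊ att j ≟ a ⌋
... | inj₂ i | inj₂ j = false

record Graph : Set₁ where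
  field
    V : Set
    E : V → V → Set
open Graph public

record _≅_ (G K : Graph) : Set where
  field
    bij : V G ↔ V K
    adj-iff : ∀ x y → E G x y ⇔ E K (Inverse.to bij x) (Inverse.to bij y)

isTDS : {m : ℕ} → FinGraph m → Subset m → Bool
isTDS {m} G S = all (λ v → any (λ u → adj G v u ∧ lookup S u) (allFin m)) (allFin m)

AddOne : {m : ℕ} → Subset m → Subset m → Set
AddOne S T = ∃ λ v → lookup S v ≡ false × T ≡ (S [ v ]≔ true)

AddDel : {m : ℕ} → Subset m → Subset m → Set
AddDel S T = AddOne S T ⊎ AddOne T S

Dt : {m : ℕ} → ℕ → FinGraph m → Graph
V (Dt {m} k G) = Σ (Subset m) λ S → T (isTDS G S ∧ (∣ S ∣ ≤ᵇ k))
E (Dt k G) (S , _) (S' , _) = AddDel S S'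

Q : ℕ → Graph
V (Q n) = Subset n
E (Q n) = AddDel

K1 : ℕ → Graph
V (K1 n) = Fin (suc n)
E (K1 n) x y = (x ≡ zero × ¬ (y ≡ zero)) ⊎ (y ≡ zero × ¬ (x ≡ zero))

module Submission where

-- In a generalized corona G of H (vertices V(H) and n leaves,
-- leaf j adjacent only to its support vertex att j, every vertex of H a
-- support vertex) every total dominating set contains all of V(H), since the
-- leaves of v are dominated by v alone.  Conversely, if H has no isolated
-- vertex then V(H) dominates all of G, so V(H) ∪ L is a TDS for every set L
-- of leaves.  Hence the TDSs of G are exactly the sets V(H) ∪ L; they differ
-- by one vertex iff the leaf sets do, and |V(H) ∪ L| = r + |L|.  So for all k
--     D^t_{r+k}(G) ≅ Q≤ n k  (subsets of an n-set of size ≤ k, add/delete),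
-- and the corollary is the instance k = n, where the bound is vacuous and
-- Q≤ n n = Q_n, and k = 1, where ∅ and the n singletons form K_{1,n}.

open import Defs
open import Data.Nat using (ℕ; zero; suc; _+_; _≤_; _≤ᵇ_; s≤s⁻¹)
open import Data.Nat.Properties using (≤ᵇ⇒≤; ≤⇒≤ᵇ; +-cancelˡ-≤; +-monoʳ-≤; n≤0⇒n≡0)
open import Data.Fin using (Fin; zero; suc; _↑ˡ_; _↑ʳ_; splitAt)
open import Data.Fin.Properties using (_≟_; splitAt-↑ˡ; splitAt-↑ʳ; splitAt⁻¹-↑ˡ; splitAt⁻¹-↑ʳ)
open import Data.Fin.Subset using (Subset; ∣_∣; ⊥; ⊤; ⁅_⁆)
open import Data.Fin.Subset.Properties using (∣p∣≤n; ∣⊥∣≡0; ∣⁅x⁆∣≡1)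
open import Data.Bool using (Bool; true; false; _∧_; T)
open import Data.Bool.Properties using (T-∧; T-≡; T-irrelevant)
open import Data.Vec using ([]; _∷_; _++_; lookup; drop; _[_]≔_)
open import Data.Vec.Properties using (lookup-++ˡ; lookup-++ʳ; []≔-++-↑ʳ; ++-injectiveʳ; lookup-replicate; take++drop≡id)
open import Data.List using (allFin)
open import Data.Bool.ListAction using (any)
open import Data.List.Membership.Propositional using (lose)
open import Data.List.Membership.Propositional.Properties using (∈-allFin)
import Data.List.Relation.Unary.All as All
open import Data.List.Relation.Unary.All.Properties using (all⁺; all⁻)
open import Data.List.Relation.Unary.Any using (satisfied)
open import Data.List.Relation.Unary.Any.Properties using (any⁺; any⁻)
open import Data.Sum using (inj₁; inj₂) renaming (map to ⊎-map)
open import Data.Product using (Σ; ∃; _×_; _,_; proj₁)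
open import Data.Unit using (tt)
open import Relation.Nullary using (¬_; contradiction)
open import Relation.Nullary.Decidable using (⌊_⌋; toWitness; fromWitness)
open import Relation.Binary.PropositionalEquality
open import Function.Bundles using (_⇔_; Equivalence; mk⇔; mk↔ₛ′)
open import Function using (_∘′_)
open import Function.Construct.Composition using (_↔-∘_; _⇔-∘_)

mkIso : ∀ {G K : Graph} (to : V G → V K) (from : V K → V G) →
        (∀ y → to (from y) ≡ y) → (∀ x → from (to x) ≡ x) →
        (∀ a b → E G (from a) (from b) ⇔ E K a b) → G ≅ K
mkIso {G} {K} to from to∘from from∘to from-adj = record
  { bij     = mk↔ₛ′ to from to∘from from∘to
  ; adj-iff = λ x y → mk⇔
      (λ p → Equivalence.to (from-adj (to x) (to y))
               (subst₂ (E G) (sym (from∘to x)) (sym (from∘to y)) p))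
      (λ q → subst₂ (E G) (from∘to x) (from∘to y)
               (Equivalence.from (from-adj (to x) (to y)) q)) }

≅-trans : ∀ {G K M : Graph} → G ≅ K → K ≅ M → G ≅ M
≅-trans i j = record
  { bij     = _≅_.bij j ↔-∘ _≅_.bij i
  ; adj-iff = λ x y → _≅_.adj-iff j _ _ ⇔-∘ _≅_.adj-iff i x y }

T-pair-≡ : ∀ {A : Set} (f : A → Bool) {x y : A} → x ≡ y → (px : T (f x)) (py : T (f y)) →
           _≡_ {A = Σ A λ a → T (f a)} (x , px) (y , py)
T-pair-≡ f {x} refl px py = cong (x ,_) (T-irrelevant px py)

Dominates : {m : ℕ} → FinGraph m → Subset m → Set
Dominates G S = ∀ v → ∃ λ u → T (adj G v u) × T (lookup S u)

isTDS-sound : ∀ {m} (G : FinGraph m) (S : Subset m) → T (isTDS G S) → Dominates G S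
isTDS-sound {m} G S tds v =
  let u , uv = satisfied (any⁻ _ (allFin m) (All.lookup (all⁺ _ (allFin m) tds) (∈-allFin v)))
  in u , Equivalence.to T-∧ uv

isTDS-complete : ∀ {m} (G : FinGraph m) (S : Subset m) → Dominates G S → T (isTDS G S)
isTDS-complete {m} G S dom =
  all⁻ (λ v → any (λ u → adj G v u ∧ lookup S u) (allFin m)) {allFin m} (All.tabulate λ {v} _ →
    let u , vu , u∈S = dom v
    in any⁺ _ (lose (∈-allFin u) (Equivalence.from T-∧ (vu , u∈S))))

data Side (r n : ℕ) : Fin (r + n) → Set where
  left  : (i : Fin r) → Side r n (i ↑ˡ n)
  right : (j : Fin n) → Side r n (r ↑ʳ j)

side : ∀ r n (x : Fin (r + n)) → Side r n x
side r n x with splitAt r x in eq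
... | inj₁ i = subst (Side r n) (splitAt⁻¹-↑ˡ eq) (left i)
... | inj₂ j = subst (Side r n) (splitAt⁻¹-↑ʳ eq) (right j)

full+ : ∀ r {n} → Subset n → Subset (r + n)
full+ r L = ⊤ {r} ++ L

full+-left : ∀ r {n} (L : Subset n) i → lookup (full+ r L) (i ↑ˡ n) ≡ true
full+-left r L i = trans (lookup-++ˡ (⊤ {r}) L i) (lookup-replicate i true)

full+-size : ∀ r {n} (L : Subset n) → ∣ full+ r L ∣ ≡ r + ∣ L ∣
full+-size zero    L = refl
full+-size (suc r) L = cong suc (full+-size r L)

full+-drop : ∀ r {n} (L : Subset n) → drop r (full+ r L) ≡ L
full+-drop r L = ++-injectiveʳ _ (⊤ {r}) (take++drop≡id r (full+ r L))

full+-shape : ∀ r {n} (S : Subset (r + n)) → (∀ i → lookup S (i ↑ˡ n) ≡ true) →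
              S ≡ full+ r (drop r S)
full+-shape zero    S       _    = refl
full+-shape (suc r) (x ∷ S) full =
  cong₂ _∷_ (full zero) (full+-shape r S (λ i → full (suc i)))

size-add : ∀ {n} (S : Subset n) v → lookup S v ≡ false → ∣ S [ v ]≔ true ∣ ≡ suc ∣ S ∣
size-add (false ∷ S) zero    _ = refl
size-add (true  ∷ S) (suc v) e = cong suc (size-add S v e)
size-add (false ∷ S) (suc v) e = size-add S v e

AddOne-size : ∀ {n} {S S′ : Subset n} → AddOne S S′ → ∣ S′ ∣ ≡ suc ∣ S ∣
AddOne-size {S = S} (v , v∉S , refl) = size-add S v v∉S

-- Since full+ r L already contains the first r points, one point can only be
-- added to it among the last n, i.e. to L.
AddOne-full+ : ∀ r {n} (L M : Subset n) → AddOne (full+ r L) (full+ r M) ⇔ AddOne L M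
AddOne-full+ r {n} L M = mk⇔ forth back
  where
  forth : AddOne (full+ r L) (full+ r M) → AddOne L M
  forth (v , v∉ , eq) with side r n v
  ... | left i with trans (sym (full+-left r L i)) v∉
  ... | ()
  forth (v , v∉ , eq) | right j =
    j , trans (sym (lookup-++ʳ (⊤ {r}) L j)) v∉ ,
    ++-injectiveʳ (⊤ {r}) (⊤ {r}) (trans eq ([]≔-++-↑ʳ (⊤ {r}) L j))
  back : AddOne L M → AddOne (full+ r L) (full+ r M)
  back (j , j∉ , eq) = r ↑ʳ j , trans (lookup-++ʳ (⊤ {r}) L j) j∉ ,
    trans (cong (full+ r) eq) (sym ([]≔-++-↑ʳ (⊤ {r}) L j))

AddDel-full+ : ∀ r {n} (L M : Subset n) → AddDel (full+ r L) (full+ r M) ⇔ AddDel L M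
AddDel-full+ r L M = mk⇔
  (⊎-map (Equivalence.to (AddOne-full+ r L M)) (Equivalence.to (AddOne-full+ r M L)))
  (⊎-map (Equivalence.from (AddOne-full+ r L M)) (Equivalence.from (AddOne-full+ r M L)))

Q≤ : ℕ → ℕ → Graph
V (Q≤ n k) = Σ (Subset n) λ L → T (∣ L ∣ ≤ᵇ k)
E (Q≤ n k) (L , _) (M , _) = AddDel L M

module Corona {r n : ℕ} (H : FinGraph r) (att : Fin n → Fin r) where

  G : FinGraph (r + n)
  G = corona H att

  adj-HH : ∀ a b → adj G (a ↑ˡ n) (b ↑ˡ n) ≡ adj H a b
  adj-HH a b rewrite splitAt-↑ˡ r a n | splitAt-↑ˡ r b n = refl

  adj-leaf-H : ∀ j a → adj G (r ↑ʳ j) (a ↑ˡ n) ≡ ⌊ att j ≟ a ⌋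
  adj-leaf-H j a rewrite splitAt-↑ʳ r n j | splitAt-↑ˡ r a n = refl

  adj-leaf-leaf : ∀ j k → adj G (r ↑ʳ j) (r ↑ʳ k) ≡ false
  adj-leaf-leaf j k rewrite splitAt-↑ʳ r n j | splitAt-↑ʳ r n k = refl

  leaf-neighbour : ∀ j u → T (adj G (r ↑ʳ j) u) → u ≡ att j ↑ˡ n
  leaf-neighbour j u uj with side r n u
  ... | left a  = cong (_↑ˡ n) (sym (toWitness (subst T (adj-leaf-H j a) uj)))
  ... | right k with subst T (adj-leaf-leaf j k) uj
  ... | ()

  -- Every TDS contains every support vertex, hence all of V(H).
  TDS-⊇-H : (∀ v → ∃ λ j → att j ≡ v) →
            ∀ S → T (isTDS G S) → ∀ i → lookup S (i ↑ˡ n) ≡ true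
  TDS-⊇-H supported S tds i with supported i
  ... | j , refl =
    let u , ju , u∈S = isTDS-sound G S tds (r ↑ʳ j)
    in Equivalence.to T-≡ (subst (T ∘′ lookup S) (leaf-neighbour j u ju) u∈S)

  full+-TDS : NoIsolated H → ∀ L → T (isTDS G (full+ r L))
  full+-TDS noIsolated L = isTDS-complete G (full+ r L) λ v → dominated v (side r n v)
    where
    inH : ∀ a → T (lookup (full+ r L) (a ↑ˡ n))
    inH a = Equivalence.from T-≡ (full+-left r L a)
    dominated : ∀ v → Side r n v →
                ∃ λ u → T (adj G v u) × T (lookup (full+ r L) u)
    dominated _ (left a) =
      let b , ab = noIsolated a in b ↑ˡ n , subst T (sym (adj-HH a b)) ab , inH b
    dominated _ (right j) =
      att j ↑ˡ n , subst T (sym (adj-leaf-H j (att j))) (fromWitness refl) , inH (att j)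

  Dt≅Q≤ : NoIsolated H → (∀ v → ∃ λ j → att j ≡ v) → ∀ k → Dt (r + k) G ≅ Q≤ n k
  Dt≅Q≤ noIsolated supported k = mkIso to from to∘from from∘to
    (λ (L , _) (M , _) → AddDel-full+ r L M)
    where
    shape : ∀ S → T (isTDS G S) → S ≡ full+ r (drop r S)
    shape S tds = full+-shape r S (TDS-⊇-H supported S tds)
    leaves-bound : ∀ S → T (isTDS G S) → ∣ S ∣ ≤ r + k → ∣ drop r S ∣ ≤ k
    leaves-bound S tds bound = +-cancelˡ-≤ r _ _
      (subst (_≤ r + k) (trans (cong ∣_∣ (shape S tds)) (full+-size r (drop r S))) bound)
    to : V (Dt (r + k) G) → V (Q≤ n k)
    to (S , p) = let tds , bound = Equivalence.to T-∧ p in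
      drop r S , ≤⇒≤ᵇ (leaves-bound S tds (≤ᵇ⇒≤ _ _ bound))
    from : V (Q≤ n k) → V (Dt (r + k) G)
    from (L , q) = full+ r L , Equivalence.from T-∧ (full+-TDS noIsolated L ,
      ≤⇒≤ᵇ (subst (_≤ r + k) (sym (full+-size r L)) (+-monoʳ-≤ r (≤ᵇ⇒≤ _ _ q))))
    to∘from : ∀ y → to (from y) ≡ y
    to∘from (L , _) = T-pair-≡ (λ M → ∣ M ∣ ≤ᵇ k) (full+-drop r L) _ _
    from∘to : ∀ x → from (to x) ≡ x
    from∘to (S , p) = T-pair-≡ (λ S′ → isTDS G S′ ∧ (∣ S′ ∣ ≤ᵇ r + k))
      (sym (shape S (proj₁ (Equivalence.to T-∧ p)))) _ _

-- Instance k = n: the size bound is vacuous.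

Q≤n≅Q : ∀ n → Q≤ n n ≅ Q n
Q≤n≅Q n = mkIso proj₁ (λ L → L , ≤⇒≤ᵇ (∣p∣≤n L)) (λ _ → refl)
  (λ (L , q) → T-pair-≡ (λ M → ∣ M ∣ ≤ᵇ n) refl _ _)
  (λ _ _ → mk⇔ (λ p → p) (λ p → p))

-- Instance k = 1: the sets of size ≤ 1 are ∅ (the centre) and singletons.

singleton : ∀ {n} → Fin (suc n) → Subset n
singleton zero    = ⊥
singleton (suc j) = ⁅ j ⁆

-- inverse on sets of size ≤ 1: the position of the first element, if any
position : ∀ {n} → Subset n → Fin (suc n)
position []          = zero
position (true  ∷ L) = suc zero
position (false ∷ L) with position L
... | zero  = zero
... | suc j = suc (suc j)

position-singleton : ∀ {n} (x : Fin (suc n)) → position (singleton x) ≡ x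
position-singleton {zero}  zero          = refl
position-singleton {suc n} zero          rewrite position-singleton {n} zero = refl
position-singleton {suc n} (suc zero)    = refl
position-singleton {suc n} (suc (suc j)) rewrite position-singleton (suc j) = refl

singleton-position : ∀ {n} (L : Subset n) → ∣ L ∣ ≤ 1 → singleton (position L) ≡ L
singleton-position []          _     = refl
singleton-position (true  ∷ L) small =
  cong (true ∷_) (sym (∣p∣≡0⇒⊥ L (n≤0⇒n≡0 (s≤s⁻¹ small))))
  where
  ∣p∣≡0⇒⊥ : ∀ {n} (p : Subset n) → ∣ p ∣ ≡ 0 → p ≡ ⊥
  ∣p∣≡0⇒⊥ []          _  = refl
  ∣p∣≡0⇒⊥ (false ∷ p) e = cong (false ∷_) (∣p∣≡0⇒⊥ p e)
singleton-position (false ∷ L) small with position L | singleton-position L small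
... | zero  | eq = cong (false ∷_) eq
... | suc j | eq = cong (false ∷_) eq

weight : ∀ {n} → Fin (suc n) → ℕ
weight zero    = 0
weight (suc _) = 1

singleton-size : ∀ {n} (x : Fin (suc n)) → ∣ singleton x ∣ ≡ weight x
singleton-size {n} zero = ∣⊥∣≡0 n
singleton-size (suc j)  = ∣⁅x⁆∣≡1 j

-- Adding a point raises the size by one, which among weights 0 and 1 only
-- happens from the centre to a leaf.
AddOne-singleton : ∀ {n} (x y : Fin (suc n)) → AddOne (singleton x) (singleton y) →
                   x ≡ zero × ¬ (y ≡ zero)
AddOne-singleton x y p = star-step x y
  (trans (sym (singleton-size y)) (trans (AddOne-size p) (cong suc (singleton-size x))))
  where
  star-step : ∀ {n} (x y : Fin (suc n)) → weight y ≡ suc (weight x) → x ≡ zero × ¬ (y ≡ zero)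
  star-step zero    (suc _) _ = refl , λ ()
  star-step zero    zero    ()
  star-step (suc _) zero    ()
  star-step (suc _) (suc _) ()

centre-to-leaf : ∀ {n} (j : Fin n) → AddOne (singleton zero) (singleton (suc j))
centre-to-leaf j = j , lookup-replicate j false , ⁅j⁆≡⊥[j]≔true j
  where
  ⁅j⁆≡⊥[j]≔true : ∀ {n} (j : Fin n) → ⁅ j ⁆ ≡ ⊥ [ j ]≔ true
  ⁅j⁆≡⊥[j]≔true zero    = refl
  ⁅j⁆≡⊥[j]≔true (suc j) = cong (false ∷_) (⁅j⁆≡⊥[j]≔true j)

Q≤1≅K1 : ∀ n → Q≤ n 1 ≅ K1 n
Q≤1≅K1 n = mkIso (λ (L , _) → position L) (λ x → singleton x , small x) position-singleton
  (λ (L , q) → T-pair-≡ (λ M → ∣ M ∣ ≤ᵇ 1) (singleton-position L (≤ᵇ⇒≤ _ _ q)) _ _)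
  (λ x y → mk⇔ (forth x y) (back x y))
  where
  small : ∀ x → T (∣ singleton x ∣ ≤ᵇ 1)
  small x = subst (λ m → T (m ≤ᵇ 1)) (sym (singleton-size x)) (weight≤1 x)
    where
    weight≤1 : ∀ x → T (weight {n} x ≤ᵇ 1)
    weight≤1 zero    = tt
    weight≤1 (suc _) = tt
  forth : ∀ x y → AddDel (singleton x) (singleton y) → E (K1 n) x y
  forth x y (inj₁ p) = inj₁ (AddOne-singleton x y p)
  forth x y (inj₂ p) = inj₂ (AddOne-singleton y x p)
  back : ∀ x y → E (K1 n) x y → AddDel (singleton x) (singleton y)
  back zero    zero    (inj₁ (_ , y≢0)) = contradiction refl y≢0
  back zero    zero    (inj₂ (_ , x≢0)) = contradiction refl x≢0
  back zero    (suc j) _               = inj₁ (centre-to-leaf j)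
  back (suc i) zero    _               = inj₂ (centre-to-leaf i)
  back (suc i) (suc j) (inj₁ (() , _))
  back (suc i) (suc j) (inj₂ (() , _))

-- Corollary 4.2.

corollary4p2 : (n r : ℕ) → 2 ≤ n → 2 ≤ r → r ≤ n →
    (H : FinGraph r) → IsSimple H → NoIsolated H →
    (att : Fin n → Fin r) → (∀ v → ∃ λ j → att j ≡ v) →
    (Dt (r + n) (corona H att) ≅ Q n) × (Dt (r + 1) (corona H att) ≅ K1 n)
corollary4p2 n r _ _ _ H _ noIsolated att supported =
  ≅-trans (Dt≅Q≤ noIsolated supported n) (Q≤n≅Q n) ,
  ≅-trans (Dt≅Q≤ noIsolated supported 1) (Q≤1≅K1 n)
  where open Corona H att using (Dt≅Q≤)
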